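{- Let $k\ge 0$ be an integer and $n=48k+46$. Define $c_3(r)\in\mathbb{Z}_n$ for $0\le r\le n-1$ as follows (all arithmetic modulo $n$): for $0\le i\le 12k+11$, $c_3(2i)=6k+6+i(12k+13)$; for $0\le i\le 12k+10$, $c_3(2i+1)=24k+24+i(12k+13)$ (this defines $c_3(r)$ for $0\le r\le 24k+22$); and for $0\le r\le 24k+22$, $c_3(n-1-r)=n-1-c_3(r)$. Let ${\cal L}_3=[l_3(r,j)]$ be the $n\times n$ array with $l_3(r,j)\equiv c_3(r)+j \pmod n$ for $0\le r,j\le n-1$. Then ${\cal L}_3$ is a Latin square of order $n$.
   Context: A Latin square of order $n$ is an $n\times n$ array in which each row and each column contains each of the symbols $0,1,\dots,n-1$ exactly once. -}

module Defs where

open import Data.Nat using (ℕ; zero; suc; _+_; _*_; _∸_; _≤?_; NonZero)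
open import Data.Nat.DivMod using (_/_; _%_)
open import Data.Fin using (Fin; toℕ; fromℕ<)
open import Data.Fin.Properties using ()
open import Data.Product using (Σ; _×_; _,_)
open import Relation.Binary.PropositionalEquality using (_≡_)
open import Relation.Nullary using (yes; no)
open import Data.Nat.DivMod using (m%n<n)

IsLatinSquare : (n : ℕ) → (Fin n → Fin n → Fin n) → Set
IsLatinSquare n L =
  ((r s : Fin n) → Σ (Fin n) λ j → (L r j ≡ s) × ((j' : Fin n) → L r j' ≡ s → j' ≡ j))
  × ((j s : Fin n) → Σ (Fin n) λ r → (L r j ≡ s) × ((r' : Fin n) → L r' j ≡ s → r' ≡ r))

-- order n = 48k+46, written as suc (48k+45) so NonZero is found automatically
ord : ℕ → ℕ
ord k = suc (48 * k + 45)

c3-first : ℕ → ℕ → ℕ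
c3-first k r with r % 2
... | 0 = (6 * k + 6 + (r / 2) * (12 * k + 13)) % ord k
... | _ = (24 * k + 24 + (r / 2) * (12 * k + 13)) % ord k

c3 : ℕ → ℕ → ℕ
c3 k r with r ≤? 24 * k + 22
... | yes _ = c3-first k r
... | no _  = (ord k ∸ 1) ∸ c3-first k ((ord k ∸ 1) ∸ r)

L3 : (k : ℕ) → Fin (ord k) → Fin (ord k) → Fin (ord k)
L3 k r j = fromℕ< (m%n<n (c3 k (toℕ r) + toℕ j) (ord k))

module Submission where

-- Put d = 12k+13 and n = 48k+46. Since d(40k+39) = 1 + (10k+11)n, d is a unit modulo n,
-- and c₃ is best read through y ↦ d·y. On the first half, c₃(2i) ≡ d(4k+4+i) and
-- c₃(2i+1) ≡ d(16k+16+i), so these rows have d-logarithms filling the interval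
-- [4k+4, 28k+26], which is half of ℤₙ. As d(8k+7) ≡ n−1, the reflection c ↦ n−1−c that
-- defines the second half is y ↦ 8k+7−y on logarithms, and it maps that interval onto its
-- complement. So c₃ is a permutation of ℤₙ, which makes each column r ↦ c₃(r)+j of L₃ a
-- permutation; each row j ↦ c₃(r)+j is one trivially.

open import Data.Nat using (ℕ; zero; suc; _+_; _*_; _∸_; pred; _≤_; _<_; _≤?_; s≤s; s≤s⁻¹; NonZero)
open import Data.Nat.Properties
open import Data.Nat.DivMod
open import Data.Nat.Divisibility using (n∣m*n)
open import Data.Nat.Tactic.RingSolver using (solve-∀)
open import Data.Fin using (Fin; toℕ; fromℕ<; punchOut)
import Data.Fin.Properties as Fin
open import Data.Product using (Σ; ∃; _×_; _,_; proj₁; proj₂)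
open import Data.Empty using (⊥-elim)
open import Function.Definitions using (Injective)
open import Relation.Nullary using (yes; no)
open import Function using (_∘_)
open import Relation.Binary.PropositionalEquality
open import Defs

Injectiveᶠ : ∀ {n} → (Fin n → Fin n) → Set
Injectiveᶠ = Injective _≡_ _≡_

Onto : ∀ {n} → (Fin n → Fin n) → Set
Onto {n} f = ∀ y → ∃ λ (x : Fin n) → f x ≡ y

injective⇒onto : ∀ {n} (f : Fin n → Fin n) → Injectiveᶠ f → Onto f
injective⇒onto {zero}  f inj ()
injective⇒onto {suc m} f inj y with Fin.any? (λ x → f x Fin.≟ y)
... | yes hit = hit
... | no miss =
  let i , j , i<j , fi≡fj = Fin.pigeonhole (n<1+n m) (λ x → punchOut (y≢f x))
  in ⊥-elim (<-irrefl (cong toℕ (inj (Fin.punchOut-injective (y≢f i) (y≢f j) fi≡fj))) i<j)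
  where
  y≢f : ∀ x → y ≢ f x
  y≢f x y≡fx = miss (x , sym y≡fx)

onto⇒injective : ∀ {n} (f : Fin n → Fin n) → Onto f → Injectiveᶠ f
onto⇒injective {n} f onto {x} {y} fx≡fy =
  let a , ga≡x = injective⇒onto g g-injective x
      b , gb≡y = injective⇒onto g g-injective y
      a≡b = begin
        a       ≡⟨ f∘g≗id a ⟨
        f (g a) ≡⟨ cong f ga≡x ⟩
        f x     ≡⟨ fx≡fy ⟩
        f y     ≡⟨ cong f gb≡y ⟨
        f (g b) ≡⟨ f∘g≗id b ⟩
        b       ∎
  in trans (sym ga≡x) (trans (cong g a≡b) gb≡y)
  where
  open ≡-Reasoning
  g : Fin n → Fin n
  g y = proj₁ (onto y)
  f∘g≗id : ∀ y → f (g y) ≡ y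
  f∘g≗id y = proj₂ (onto y)
  g-injective : Injectiveᶠ g
  g-injective {a} {b} ga≡gb = trans (sym (f∘g≗id a)) (trans (cong f ga≡gb) (f∘g≗id b))

unique-preimage : ∀ {n} (f : Fin n → Fin n) → Injectiveᶠ f →
                  ∀ y → Σ (Fin n) λ x → (f x ≡ y) × (∀ x' → f x' ≡ y → x' ≡ x)
unique-preimage f inj y with x , fx≡y ← injective⇒onto f inj y = x , fx≡y , λ x' fx'≡y → inj (trans fx'≡y (sym fx≡y))

injective-lines⇒IsLatinSquare : ∀ {n} (L : Fin n → Fin n → Fin n) →
                                (∀ r → Injectiveᶠ (L r)) → (∀ j → Injectiveᶠ (λ r → L r j)) →
                                IsLatinSquare n L
injective-lines⇒IsLatinSquare L rows columns =
  (λ r → unique-preimage (L r) (rows r)) , (λ j → unique-preimage (λ r → L r j) (columns j))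

module _ {n : ℕ} .{{_ : NonZero n}} where

  +-congˡ-% : ∀ c {a b} → a % n ≡ b % n → (c + a) % n ≡ (c + b) % n
  +-congˡ-% c {a} {b} a≡b = begin
    (c + a) % n             ≡⟨ %-distribˡ-+ c a n ⟩
    (c % n + a % n) % n     ≡⟨ cong (λ x → (c % n + x) % n) a≡b ⟩
    (c % n + b % n) % n     ≡⟨ %-distribˡ-+ c b n ⟨
    (c + b) % n             ∎
    where open ≡-Reasoning

  *-congˡ-% : ∀ c {a b} → a % n ≡ b % n → (c * a) % n ≡ (c * b) % n
  *-congˡ-% c {a} {b} a≡b = begin
    (c * a) % n             ≡⟨ %-distribˡ-* c a n ⟩
    (c % n * (a % n)) % n   ≡⟨ cong (λ x → (c % n * x) % n) a≡b ⟩
    (c % n * (b % n)) % n   ≡⟨ %-distribˡ-* c b n ⟨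
    (c * b) % n             ∎
    where open ≡-Reasoning

  +-cancelˡ-% : ∀ c {a b} → (c + a) % n ≡ (c + b) % n → a % n ≡ b % n
  +-cancelˡ-% c {a} {b} ca≡cb = begin
    a % n                          ≡⟨ [m+kn]%n≡m%n a c n ⟨
    (a + c * n) % n                ≡⟨ cong (_% n) (shift a) ⟩
    (pred n * c + (c + a)) % n    ≡⟨ +-congˡ-% (pred n * c) ca≡cb ⟩
    (pred n * c + (c + b)) % n    ≡⟨ cong (_% n) (shift b) ⟨
    (b + c * n) % n                ≡⟨ [m+kn]%n≡m%n b c n ⟩
    b % n                          ∎
    where
    open ≡-Reasoning
    -- pred n * c is an additive inverse of c modulo n
    shift : ∀ x → x + c * n ≡ pred n * c + (c + x)
    shift x = trans (cong (λ m → x + c * m) (sym (suc-pred n))) (ring x c (pred n))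
      where
      ring : ∀ x c p → x + c * suc p ≡ p * c + (c + x)
      ring = solve-∀

  %≡⇒≡ : ∀ {m o} → m % n ≡ o → m < o + n → m ≡ o
  %≡⇒≡ {m} {o} m%n≡o m<o+n with m / n in eq
  ... | zero  = begin
    m                     ≡⟨ m≡m%n+[m/n]*n m n ⟩
    m % n + m / n * n     ≡⟨ cong (λ q → m % n + q * n) eq ⟩
    m % n + 0             ≡⟨ +-identityʳ (m % n) ⟩
    m % n                 ≡⟨ m%n≡o ⟩
    o                     ∎
    where open ≡-Reasoning
  ... | suc q = ⊥-elim (<⇒≱ m<o+n (begin
    o + n                 ≤⟨ m≤m+n (o + n) (q * n) ⟩
    o + n + q * n         ≡⟨ +-assoc o n (q * n) ⟩
    o + suc q * n         ≡⟨ cong (λ x → x + suc q * n) m%n≡o ⟨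
    m % n + suc q * n     ≡⟨ cong (λ x → m % n + x * n) eq ⟨
    m % n + m / n * n     ≡⟨ m≡m%n+[m/n]*n m n ⟨
    m                     ∎))
    where open ≤-Reasoning

residue : ∀ {n} .{{_ : NonZero n}} → ℕ → Fin n
residue {n} m = fromℕ< (m%n<n m n)

module _ {n : ℕ} .{{_ : NonZero n}} where

  residue-toℕ : ∀ (i : Fin n) → residue (toℕ i) ≡ i
  residue-toℕ i = Fin.toℕ-injective (trans (Fin.toℕ-fromℕ< (m%n<n (toℕ i) n)) (m<n⇒m%n≡m (Fin.toℕ<n i)))

  residue-+-cancelˡ : ∀ c {a b} → residue {n} (c + a) ≡ residue (c + b) → residue {n} a ≡ residue b
  residue-+-cancelˡ c {a} {b} eq = Fin.toℕ-injective (begin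
    toℕ (residue a)       ≡⟨ Fin.toℕ-fromℕ< (m%n<n a n) ⟩
    a % n                 ≡⟨ +-cancelˡ-% c (begin
      (c + a) % n             ≡⟨ Fin.toℕ-fromℕ< (m%n<n (c + a) n) ⟨
      toℕ (residue (c + a))   ≡⟨ cong toℕ eq ⟩
      toℕ (residue (c + b))   ≡⟨ Fin.toℕ-fromℕ< (m%n<n (c + b) n) ⟩
      (c + b) % n             ∎) ⟩
    b % n                 ≡⟨ Fin.toℕ-fromℕ< (m%n<n b n) ⟨
    toℕ (residue b)       ∎)
    where open ≡-Reasoning

c3-first-even : ∀ k i → c3-first k (i * 2) ≡ (6 * k + 6 + i * (12 * k + 13)) % ord k
c3-first-even k i with (i * 2) % 2 | [m+kn]%n≡m%n 0 i 2
... | .0 | refl = cong (λ h → (6 * k + 6 + h * (12 * k + 13)) % ord k) (m*n/n≡m i 2)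

c3-first-odd : ∀ k i → c3-first k (1 + i * 2) ≡ (24 * k + 24 + i * (12 * k + 13)) % ord k
c3-first-odd k i with (1 + i * 2) % 2 | [m+kn]%n≡m%n 1 i 2
... | .1 | refl = cong (λ h → (24 * k + 24 + h * (12 * k + 13)) % ord k) (trans (+-distrib-/-∣ʳ 1 {d = 2} (n∣m*n i)) (m*n/n≡m i 2))

first-half<ord : ∀ k {r} → r ≤ 24 * k + 22 → r < ord k
first-half<ord k r≤ = s≤s (≤-trans r≤ (≤-trans (m≤m+n _ (24 * k + 23)) (≤-reflexive (ring k))))
  where
  ring : ∀ k → 24 * k + 22 + (24 * k + 23) ≡ 48 * k + 45
  ring = solve-∀

c3≡c3-first : ∀ k r → r ≤ 24 * k + 22 → c3 k r ≡ c3-first k r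
c3≡c3-first k r r≤ with r ≤? 24 * k + 22
... | yes _  = refl
... | no r≰ = ⊥-elim (r≰ r≤)

c3-reflect : ∀ k r → r ≤ 24 * k + 22 → c3 k (48 * k + 45 ∸ r) ≡ 48 * k + 45 ∸ c3 k r
c3-reflect k r r≤ with 48 * k + 45 ∸ r ≤? 24 * k + 22
... | yes r̄≤ = ⊥-elim (n≮n (48 * k + 44) (begin
  suc (48 * k + 44)                       ≡⟨ ring₁ k ⟩
  48 * k + 45                             ≤⟨ m≤n+m∸n (48 * k + 45) r ⟩
  r + (48 * k + 45 ∸ r)                   ≤⟨ +-mono-≤ r≤ r̄≤ ⟩
  (24 * k + 22) + (24 * k + 22)           ≡⟨ ring₂ k ⟩
  48 * k + 44                             ∎))
  where
  open ≤-Reasoning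
  ring₁ : ∀ k → suc (48 * k + 44) ≡ 48 * k + 45
  ring₁ = solve-∀
  ring₂ : ∀ k → (24 * k + 22) + (24 * k + 22) ≡ 48 * k + 44
  ring₂ = solve-∀
... | no _ = cong (λ x → 48 * k + 45 ∸ x)
                 (trans (cong (c3-first k) (m∸[m∸n]≡n (s≤s⁻¹ (first-half<ord k r≤)))) (sym (c3≡c3-first k r r≤)))

first-half-preimage : ∀ k t → t ≤ 24 * k + 22 →
                      ∃ λ r → r ≤ 24 * k + 22 × c3 k r ≡ ((12 * k + 13) * (4 * k + 4 + t)) % ord k
first-half-preimage k t t≤ with t ≤? 12 * k + 11
... | yes t≤′ = t * 2 , r≤ , (begin
  c3 k (t * 2)                                            ≡⟨ c3≡c3-first k (t * 2) r≤ ⟩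
  c3-first k (t * 2)                                      ≡⟨ c3-first-even k t ⟩
  (6 * k + 6 + t * (12 * k + 13)) % ord k                 ≡⟨ [m+kn]%n≡m%n (6 * k + 6 + t * (12 * k + 13)) (suc k) (ord k) ⟨
  (6 * k + 6 + t * (12 * k + 13) + suc k * ord k) % ord k ≡⟨ cong (_% ord k) (ring k t) ⟩
  ((12 * k + 13) * (4 * k + 4 + t)) % ord k               ∎)
  where
  open ≡-Reasoning
  r≤ : t * 2 ≤ 24 * k + 22
  r≤ = ≤-trans (*-monoˡ-≤ 2 t≤′) (≤-reflexive (ring′ k))
    where
    ring′ : ∀ k → (12 * k + 11) * 2 ≡ 24 * k + 22
    ring′ = solve-∀
  ring : ∀ k t → 6 * k + 6 + t * (12 * k + 13) + suc k * suc (48 * k + 45) ≡ (12 * k + 13) * (4 * k + 4 + t)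
  ring = solve-∀
... | no t≰ with i , refl ← m≤n⇒∃[o]m+o≡n (≰⇒> t≰) = 1 + i * 2 , r≤ , (begin
  c3 k (1 + i * 2)                                               ≡⟨ c3≡c3-first k (1 + i * 2) r≤ ⟩
  c3-first k (1 + i * 2)                                         ≡⟨ c3-first-odd k i ⟩
  (24 * k + 24 + i * (12 * k + 13)) % ord k                      ≡⟨ [m+kn]%n≡m%n (24 * k + 24 + i * (12 * k + 13)) (4 * k + 4) (ord k) ⟨
  (24 * k + 24 + i * (12 * k + 13) + (4 * k + 4) * ord k) % ord k ≡⟨ cong (_% ord k) (ring k i) ⟩
  ((12 * k + 13) * (4 * k + 4 + (suc (12 * k + 11) + i))) % ord k ∎)
  where
  open ≡-Reasoning
  i≤ : i ≤ 12 * k + 10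
  i≤ = +-cancelˡ-≤ (suc (12 * k + 11)) i (12 * k + 10) (≤-trans t≤ (≤-reflexive (ring′ k)))
    where
    ring′ : ∀ k → 24 * k + 22 ≡ suc (12 * k + 11) + (12 * k + 10)
    ring′ = solve-∀
  r≤ : 1 + i * 2 ≤ 24 * k + 22
  r≤ = ≤-trans (s≤s (*-monoˡ-≤ 2 i≤)) (≤-trans (n≤1+n _) (≤-reflexive (ring′ k)))
    where
    ring′ : ∀ k → suc (1 + (12 * k + 10) * 2) ≡ 24 * k + 22
    ring′ = solve-∀
  ring : ∀ k i → 24 * k + 24 + i * (12 * k + 13) + (4 * k + 4) * suc (48 * k + 45)
                 ≡ (12 * k + 13) * (4 * k + 4 + (suc (12 * k + 11) + i))
  ring = solve-∀

step-invertible : ∀ k v → v < ord k → ∃ λ y → y < ord k × ((12 * k + 13) * y) % ord k ≡ v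
step-invertible k v v<n = y , m%n<n ((40 * k + 39) * v) (ord k) , (begin
  ((12 * k + 13) * y) % ord k                              ≡⟨ *-congˡ-% (12 * k + 13) (m%n%n≡m%n ((40 * k + 39) * v) (ord k)) ⟩
  ((12 * k + 13) * ((40 * k + 39) * v)) % ord k            ≡⟨ cong (_% ord k) (ring k v) ⟩
  (v + ((10 * k + 11) * v) * ord k) % ord k                ≡⟨ [m+kn]%n≡m%n v ((10 * k + 11) * v) (ord k) ⟩
  v % ord k                                                ≡⟨ m<n⇒m%n≡m v<n ⟩
  v                                                        ∎)
  where
  open ≡-Reasoning
  y : ℕ
  y = ((40 * k + 39) * v) % ord k
  ring : ∀ k v → (12 * k + 13) * ((40 * k + 39) * v) ≡ v + ((10 * k + 11) * v) * suc (48 * k + 45)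
  ring = solve-∀

step-reflection : ∀ k m → ((12 * k + 13) * (8 * k + 7 + m * ord k)) % ord k ≡ 48 * k + 45
step-reflection k m = begin
  ((12 * k + 13) * (8 * k + 7 + m * ord k)) % ord k                       ≡⟨ cong (_% ord k) (ring k m) ⟩
  (48 * k + 45 + (2 * k + 1 + (12 * k + 13) * m) * ord k) % ord k         ≡⟨ [m+kn]%n≡m%n (48 * k + 45) (2 * k + 1 + (12 * k + 13) * m) (ord k) ⟩
  (48 * k + 45) % ord k                                                   ≡⟨ m<n⇒m%n≡m ≤-refl ⟩
  48 * k + 45                                                             ∎
  where
  open ≡-Reasoning
  ring : ∀ k m → (12 * k + 13) * (8 * k + 7 + m * suc (48 * k + 45))
                 ≡ 48 * k + 45 + (2 * k + 1 + (12 * k + 13) * m) * suc (48 * k + 45)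
  ring = solve-∀

Preimage : ℕ → ℕ → Set
Preimage k v = ∃ λ r → r < ord k × c3 k r ≡ v

preimage-by-reflection : ∀ k v y t → v < ord k → ((12 * k + 13) * y) % ord k ≡ v → t ≤ 24 * k + 22 →
                         ((12 * k + 13) * (y + (4 * k + 4 + t))) % ord k ≡ 48 * k + 45 → Preimage k v
preimage-by-reflection k v y t v<n dy≡v t≤ dy+dy′≡n-1 =
  48 * k + 45 ∸ r′ , s≤s (m∸n≤m _ r′) , (begin
    c3 k (48 * k + 45 ∸ r′)   ≡⟨ c3-reflect k r′ r′≤ ⟩
    48 * k + 45 ∸ w           ≡⟨ cong (_∸ w) v+w≡n-1 ⟨
    v + w ∸ w                 ≡⟨ m+n∸n≡m v w ⟩
    v                         ∎)
  where
  open ≡-Reasoning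
  d y′ r′ w : ℕ
  d = 12 * k + 13
  y′ = 4 * k + 4 + t
  r′ = proj₁ (first-half-preimage k t t≤)
  w = c3 k r′
  r′≤ : r′ ≤ 24 * k + 22
  r′≤ = proj₁ (proj₂ (first-half-preimage k t t≤))
  w≡dy′ : w ≡ (d * y′) % ord k
  w≡dy′ = proj₂ (proj₂ (first-half-preimage k t t≤))
  v+w≡n-1 : v + w ≡ 48 * k + 45
  v+w≡n-1 = %≡⇒≡ (begin
    (v + w) % ord k                            ≡⟨ cong₂ (λ a b → (a + b) % ord k) (sym dy≡v) w≡dy′ ⟩
    ((d * y) % ord k + (d * y′) % ord k) % ord k ≡⟨ %-distribˡ-+ (d * y) (d * y′) (ord k) ⟨
    (d * y + d * y′) % ord k                   ≡⟨ cong (_% ord k) (*-distribˡ-+ d y y′) ⟨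
    (d * (y + y′)) % ord k                     ≡⟨ dy+dy′≡n-1 ⟩
    48 * k + 45                                ∎)
    (+-mono-≤-< (s≤s⁻¹ v<n) (subst (_< ord k) (sym w≡dy′) (m%n<n (d * y′) (ord k))))

mirror-below : ∀ k y → y ≤ 4 * k + 3 →
               ∃ λ t → t ≤ 24 * k + 22 × ((12 * k + 13) * (y + (4 * k + 4 + t))) % ord k ≡ 48 * k + 45
mirror-below k y y≤ = 4 * k + 3 ∸ y , ≤-trans (m∸n≤m _ y) (ring₁ k) ,
  trans (cong (λ x → ((12 * k + 13) * x) % ord k) y+y′≡) (step-reflection k 0)
  where
  open ≡-Reasoning
  ring₁ : ∀ k → 4 * k + 3 ≤ 24 * k + 22
  ring₁ k = ≤-trans (m≤m+n _ (20 * k + 19)) (≤-reflexive (ring k))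
    where
    ring : ∀ k → 4 * k + 3 + (20 * k + 19) ≡ 24 * k + 22
    ring = solve-∀
  y+y′≡ : y + (4 * k + 4 + (4 * k + 3 ∸ y)) ≡ 8 * k + 7 + 0 * ord k
  y+y′≡ = begin
    y + (4 * k + 4 + (4 * k + 3 ∸ y))     ≡⟨ shuffle y (4 * k + 4) (4 * k + 3 ∸ y) ⟩
    4 * k + 4 + (y + (4 * k + 3 ∸ y))     ≡⟨ cong (4 * k + 4 +_) (m+[n∸m]≡n y≤) ⟩
    4 * k + 4 + (4 * k + 3)               ≡⟨ ring k ⟩
    8 * k + 7 + 0 * ord k                 ∎
    where
    shuffle : ∀ a b c → a + (b + c) ≡ b + (a + c)
    shuffle = solve-∀
    ring : ∀ k → 4 * k + 4 + (4 * k + 3) ≡ 8 * k + 7 + 0 * suc (48 * k + 45)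
    ring = solve-∀

mirror-above : ∀ k y → 28 * k + 26 < y → y < ord k →
               ∃ λ t → t ≤ 24 * k + 22 × ((12 * k + 13) * (y + (4 * k + 4 + t))) % ord k ≡ 48 * k + 45
mirror-above k y y> y<n with s , refl ← m≤n⇒∃[o]m+o≡n y> =
  4 * k + 4 + (20 * k + 18 ∸ s) , t≤ ,
  trans (cong (λ x → ((12 * k + 13) * x) % ord k) y+y′≡) (step-reflection k 1)
  where
  open ≡-Reasoning
  s≤ : s ≤ 20 * k + 18
  s≤ = +-cancelˡ-≤ (suc (28 * k + 26)) s (20 * k + 18) (≤-trans (s≤s⁻¹ y<n) (≤-reflexive (ring k)))
    where
    ring : ∀ k → 48 * k + 45 ≡ suc (28 * k + 26) + (20 * k + 18)
    ring = solve-∀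
  t≤ : 4 * k + 4 + (20 * k + 18 ∸ s) ≤ 24 * k + 22
  t≤ = ≤-trans (+-monoʳ-≤ (4 * k + 4) (m∸n≤m _ s)) (≤-reflexive (ring k))
    where
    ring : ∀ k → 4 * k + 4 + (20 * k + 18) ≡ 24 * k + 22
    ring = solve-∀
  y+y′≡ : suc (28 * k + 26) + s + (4 * k + 4 + (4 * k + 4 + (20 * k + 18 ∸ s))) ≡ 8 * k + 7 + 1 * ord k
  y+y′≡ = begin
    suc (28 * k + 26) + s + (4 * k + 4 + (4 * k + 4 + (20 * k + 18 ∸ s)))  ≡⟨ shuffle k s (20 * k + 18 ∸ s) ⟩
    36 * k + 35 + (s + (20 * k + 18 ∸ s))                                  ≡⟨ cong (36 * k + 35 +_) (m+[n∸m]≡n s≤) ⟩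
    36 * k + 35 + (20 * k + 18)                                            ≡⟨ ring k ⟩
    8 * k + 7 + 1 * ord k                                                  ∎
    where
    shuffle : ∀ k s u → suc (28 * k + 26) + s + (4 * k + 4 + (4 * k + 4 + u)) ≡ 36 * k + 35 + (s + u)
    shuffle = solve-∀
    ring : ∀ k → 36 * k + 35 + (20 * k + 18) ≡ 8 * k + 7 + 1 * suc (48 * k + 45)
    ring = solve-∀

preimage-inside : ∀ k v y → 4 * k + 3 < y → y ≤ 28 * k + 26 → ((12 * k + 13) * y) % ord k ≡ v → Preimage k v
preimage-inside k v y y> y≤ dy≡v with t , refl ← m≤n⇒∃[o]m+o≡n y> =
  let r , r≤ , c3r≡ = first-half-preimage k t t≤
  in r , first-half<ord k r≤ , trans c3r≡ (trans (cong (λ x → ((12 * k + 13) * x) % ord k) (ring₁ k t)) dy≡v)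
  where
  ring₁ : ∀ k t → 4 * k + 4 + t ≡ suc (4 * k + 3) + t
  ring₁ = solve-∀
  t≤ : t ≤ 24 * k + 22
  t≤ = +-cancelˡ-≤ (suc (4 * k + 3)) t (24 * k + 22) (≤-trans y≤ (≤-reflexive (ring k)))
    where
    ring : ∀ k → 28 * k + 26 ≡ suc (4 * k + 3) + (24 * k + 22)
    ring = solve-∀

preimage-from-log : ∀ k v y → v < ord k → y < ord k → ((12 * k + 13) * y) % ord k ≡ v → Preimage k v
preimage-from-log k v y v<n y<n dy≡v with y ≤? 4 * k + 3 | y ≤? 28 * k + 26
... | yes y≤ | _      = let t , t≤ , mirror = mirror-below k y y≤
                        in preimage-by-reflection k v y t v<n dy≡v t≤ mirror
... | no y≰  | yes y≤ = preimage-inside k v y (≰⇒> y≰) y≤ dy≡v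
... | no _   | no y≰  = let t , t≤ , mirror = mirror-above k y (≰⇒> y≰) y<n
                        in preimage-by-reflection k v y t v<n dy≡v t≤ mirror

c3-onto : ∀ k v → v < ord k → Preimage k v
c3-onto k v v<n = let y , y<n , dy≡v = step-invertible k v v<n in preimage-from-log k v y v<n y<n dy≡v

column-shift : ∀ k → Fin (ord k) → Fin (ord k)
column-shift k r = residue (c3 k (toℕ r))

column-shift-onto : ∀ k → Onto (column-shift k)
column-shift-onto k v =
  let r , r<n , c3r≡v = c3-onto k (toℕ v) (Fin.toℕ<n v)
  in fromℕ< r<n , (begin
    residue (c3 k (toℕ (fromℕ< r<n)))   ≡⟨ cong (residue ∘ c3 k) (Fin.toℕ-fromℕ< r<n) ⟩
    residue (c3 k r)                    ≡⟨ cong residue c3r≡v ⟩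
    residue (toℕ v)                     ≡⟨ residue-toℕ v ⟩
    v                                   ∎)
  where open ≡-Reasoning

row-injective : ∀ k r → Injectiveᶠ (L3 k r)
row-injective k r {j} {j′} eq = begin
  j                   ≡⟨ residue-toℕ j ⟨
  residue (toℕ j)     ≡⟨ residue-+-cancelˡ (c3 k (toℕ r)) eq ⟩
  residue (toℕ j′)    ≡⟨ residue-toℕ j′ ⟩
  j′                  ∎
  where open ≡-Reasoning

column-injective : ∀ k j → Injectiveᶠ (λ r → L3 k r j)
column-injective k j {r} {r′} eq = onto⇒injective (column-shift k) (column-shift-onto k)
  (residue-+-cancelˡ (toℕ j) (subst₂ (λ a b → residue {ord k} a ≡ residue b) (+-comm c (toℕ j)) (+-comm c′ (toℕ j)) eq))
  where
  c c′ : ℕ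
  c = c3 k (toℕ r)
  c′ = c3 k (toℕ r′)

lemma12 : (k : ℕ) → IsLatinSquare (ord k) (L3 k)
lemma12 k = injective-lines⇒IsLatinSquare (L3 k) (row-injective k) (column-injective k)
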